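{- Let $K_{m,n}$ be the complete bipartite graph with $m,n\geq 2$. Then for any edge $e$, $-2$ is an eigenvalue of the eccentricity matrix $\varepsilon(K_{m,n}-e)$ with multiplicity at least $m+n-4$.
   Context: All graphs are finite, simple and connected. For a connected graph $G$, $d_G(u,v)$ is the length of a shortest $u$–$v$ path, and the eccentricity of a vertex $u$ is $e(u)=\max\{d_G(u,v): v\in V(G)\}$. The eccentricity matrix $\varepsilon(G)$ is the $|V(G)|\times|V(G)|$ matrix indexed by $V(G)$ with $\varepsilon(G)_{uv}=d_G(u,v)$ if $d_G(u,v)=\min\{e(u),e(v)\}$ and $\varepsilon(G)_{uv}=0$ otherwise. $G-e$ denotes the graph obtained from $G$ by deleting the edge $e$ (keeping all vertices). -}

module Defs where

open import Data.Bool using (Bool; true; false; _∧_; _∨_; not; if_then_else_)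
open import Data.Nat using (ℕ; zero; suc; _+_; _⊔_; _⊓_; _≡ᵇ_)
open import Data.Fin using (Fin; splitAt; _≟_)
import Data.Fin as F
open import Data.Sum using (_⊎_; inj₁; inj₂)
open import Data.Product using (Σ; _×_)
open import Data.Integer using (ℤ; +_) renaming (_+_ to _+ℤ_; _*_ to _*ℤ_)
open import Relation.Nullary.Decidable using (⌊_⌋)
open import Relation.Binary.PropositionalEquality using (_≡_)

Graph : ℕ → Set
Graph N = Fin N → Fin N → Bool

anyFin : ∀ {N} → (Fin N → Bool) → Bool
anyFin {zero}  p = false
anyFin {suc N} p = p F.zero ∨ anyFin (λ i → p (F.suc i))

maxFin : ∀ {N} → (Fin N → ℕ) → ℕ
maxFin {zero}  f = 0
maxFin {suc N} f = f F.zero ⊔ maxFin (λ i → f (F.suc i))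

sumFin : ∀ {N} → (Fin N → ℤ) → ℤ
sumFin {zero}  f = + 0
sumFin {suc N} f = f F.zero +ℤ sumFin (λ i → f (F.suc i))

walkWithin : ∀ {N} → Graph N → ℕ → Fin N → Fin N → Bool
walkWithin G zero    u v = ⌊ u ≟ v ⌋
walkWithin G (suc k) u v = walkWithin G k u v ∨ anyFin (λ w → G u w ∧ walkWithin G k w v)

firstFrom : ℕ → (ℕ → Bool) → ℕ → ℕ
firstFrom zero     p k = k
firstFrom (suc f) p k = if p k then k else firstFrom f p (suc k)

-- Distance d_G(u,v): the least k with a u–v walk of length ≤ k
-- (for a connected graph on N vertices this is found among 0..N-1).
dist : ∀ {N} → Graph N → Fin N → Fin N → ℕ
dist {N} G u v = firstFrom N (λ k → walkWithin G k u v) 0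

ecc : ∀ {N} → Graph N → Fin N → ℕ
ecc G u = maxFin (λ v → dist G u v)

eccMatrix : ∀ {N} → Graph N → Fin N → Fin N → ℤ
eccMatrix G u v =
  if dist G u v ≡ᵇ (ecc G u ⊓ ecc G v) then + dist G u v else + 0

-- K_{m,n} - e, where e = {i, j} with i in the first part (Fin m) and
-- j in the second part (Fin n).  Vertices: Fin (m + n), split by splitAt m.
KmnMinusEdge : (m n : ℕ) → Fin m → Fin n → Graph (m + n)
KmnMinusEdge m n i j x y with splitAt m x | splitAt m y
... | inj₁ a | inj₂ b = not (⌊ a ≟ i ⌋ ∧ ⌊ b ≟ j ⌋)
... | inj₂ b | inj₁ a = not (⌊ a ≟ i ⌋ ∧ ⌊ b ≟ j ⌋)
... | inj₁ _ | inj₁ _ = false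
... | inj₂ _ | inj₂ _ = false

mulVec : ∀ {N} → (Fin N → Fin N → ℤ) → (Fin N → ℤ) → Fin N → ℤ
mulVec A v x = sumFin (λ y → A x y *ℤ v y)

IsEigenvector : ∀ {N} → (Fin N → Fin N → ℤ) → ℤ → (Fin N → ℤ) → Set
IsEigenvector A λ₀ v = ∀ x → mulVec A v x ≡ λ₀ *ℤ v x

-- Linear independence of a family of k integer vectors (over ℤ, equivalently over ℚ).
LinIndep : ∀ {k N} → (Fin k → Fin N → ℤ) → Set
LinIndep {k} {N} vs =
  (c : Fin k → ℤ) → (∀ x → sumFin (λ i → c i *ℤ vs i x) ≡ + 0) → ∀ i → c i ≡ + 0

-- λ₀ is an eigenvalue of A with (geometric) multiplicity at least k:
-- the λ₀-eigenspace contains k linearly independent vectors.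
EigMultAtLeast : ∀ {N} → (Fin N → Fin N → ℤ) → ℤ → ℕ → Set
EigMultAtLeast {N} A λ₀ k =
  Σ (Fin k → Fin N → ℤ) (λ vs → LinIndep vs × (∀ i → IsEigenvector A λ₀ (vs i)))

-- Let e = ij. Every vertex other than i and j is adjacent to the whole opposite
-- part, so it has eccentricity 2, while every vertex has eccentricity at least 2
-- (it has a second vertex in its own part, at distance 2). Hence the column of
-- ε(K_{m,n} - e) at a vertex p ∉ {i, j} has entry 2 at the other vertices of p's
-- part and 0 elsewhere. For two such vertices p ≠ q in the same part, e_p - e_q is
-- therefore a (-2)-eigenvector. Fixing one such anchor in each part and pairing it
-- with the remaining (m - 2) + (n - 2) vertices off e gives linearly independent
-- eigenvectors: each of them is the only one that is nonzero at its own vertex p.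
module Submission where

open import Defs
open import Data.Bool using (Bool; true; false; _∧_; not; if_then_else_)
import Data.Bool.Properties as Bool
open import Data.Empty using (⊥-elim)
open import Data.Fin using (Fin; zero; suc; splitAt; join; punchIn)
open import Data.Fin.Properties
  using (_≟_; splitAt-join; join-splitAt; punchInᵢ≢i; punchIn-injective; suc-injective)
open import Data.Integer using (ℤ; _-_; 0ℤ; 1ℤ; +_; -[1+_]) renaming (_+_ to _+ℤ_; _*_ to _*ℤ_)
import Data.Integer.Properties as ℤ
open import Data.Integer.Tactic.RingSolver using (solve-∀)
open import Data.Nat using (ℕ; zero; suc; _+_; _∸_; _≤_; _≡ᵇ_; z≤n; s≤s)
open import Data.Nat.Properties
  using (≤-trans; ≤-antisym; ≤-reflexive; m≤m⊔n; m≤n⊔m; ⊔-lub; ≤∧≢⇒<; m≥n⇒m⊓n≡n; +-∸-assoc)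
open import Data.Product using (∃; _×_; _,_)
open import Data.Sum using (_⊎_; inj₁; inj₂)
open import Data.Sum.Properties using (inj₁-injective; inj₂-injective)
open import Function using (_∘_; flip)
open import Relation.Binary.PropositionalEquality
open import Relation.Nullary using (yes; no)
open import Relation.Nullary.Decidable using (⌊_⌋)

anyFin-witness : ∀ {N} (p : Fin N → Bool) w → p w ≡ true → anyFin p ≡ true
anyFin-witness p zero    pw rewrite pw = refl
anyFin-witness p (suc w) pw
  rewrite anyFin-witness (p ∘ suc) w pw = Bool.∨-zeroʳ (p zero)

anyFin-none : ∀ {N} (p : Fin N → Bool) → (∀ w → p w ≡ false) → anyFin p ≡ false
anyFin-none {zero}  p none = refl
anyFin-none {suc N} p none rewrite none zero = anyFin-none (p ∘ suc) (none ∘ suc)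

≤-maxFin : ∀ {N} (f : Fin N → ℕ) w → f w ≤ maxFin f
≤-maxFin f zero    = m≤m⊔n (f zero) _
≤-maxFin f (suc w) = ≤-trans (≤-maxFin (f ∘ suc) w) (m≤n⊔m (f zero) _)

maxFin-lub : ∀ {N} (f : Fin N → ℕ) c → (∀ w → f w ≤ c) → maxFin f ≤ c
maxFin-lub {zero}  f c ub = z≤n
maxFin-lub {suc N} f c ub = ⊔-lub (ub zero) (maxFin-lub (f ∘ suc) c (ub ∘ suc))

sumFin-cong : ∀ {N} {f g : Fin N → ℤ} → (∀ x → f x ≡ g x) → sumFin f ≡ sumFin g
sumFin-cong {zero}  f≗g = refl
sumFin-cong {suc N} f≗g = cong₂ _+ℤ_ (f≗g zero) (sumFin-cong (f≗g ∘ suc))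

sumFin-zero : ∀ {N} {f : Fin N → ℤ} → (∀ x → f x ≡ 0ℤ) → sumFin f ≡ 0ℤ
sumFin-zero {zero}  f≗0 = refl
sumFin-zero {suc N} f≗0 = cong₂ _+ℤ_ (f≗0 zero) (sumFin-zero (f≗0 ∘ suc))

sumFin-distrib-minus : ∀ {N} (f g : Fin N → ℤ) →
                       sumFin (λ x → f x - g x) ≡ sumFin f - sumFin g
sumFin-distrib-minus {zero}  f g = refl
sumFin-distrib-minus {suc N} f g = begin
  (f zero - g zero) +ℤ sumFin (λ x → f (suc x) - g (suc x))
    ≡⟨ cong (f zero - g zero +ℤ_) (sumFin-distrib-minus (f ∘ suc) (g ∘ suc)) ⟩
  (f zero - g zero) +ℤ (sumFin (f ∘ suc) - sumFin (g ∘ suc))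
    ≡⟨ interchange (f zero) (g zero) (sumFin (f ∘ suc)) (sumFin (g ∘ suc)) ⟩
  (f zero +ℤ sumFin (f ∘ suc)) - (g zero +ℤ sumFin (g ∘ suc)) ∎
  where
  open ≡-Reasoning
  interchange : ∀ a b c d → (a - b) +ℤ (c - d) ≡ (a +ℤ c) - (b +ℤ d)
  interchange = solve-∀

basis : ∀ {N} → Fin N → Fin N → ℤ
basis zero    zero    = 1ℤ
basis zero    (suc _) = 0ℤ
basis (suc _) zero    = 0ℤ
basis (suc p) (suc y) = basis p y

basis-comm : ∀ {N} (p y : Fin N) → basis p y ≡ basis y p
basis-comm zero    zero    = refl
basis-comm zero    (suc _) = refl
basis-comm (suc _) zero    = refl
basis-comm (suc p) (suc y) = basis-comm p y

basis-diagonal : ∀ {N} (p : Fin N) → basis p p ≡ 1ℤ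
basis-diagonal zero    = refl
basis-diagonal (suc p) = basis-diagonal p

basis-offDiagonal : ∀ {N} {p y : Fin N} → p ≢ y → basis p y ≡ 0ℤ
basis-offDiagonal {p = zero}  {zero}  p≢y = ⊥-elim (p≢y refl)
basis-offDiagonal {p = zero}  {suc _} p≢y = refl
basis-offDiagonal {p = suc _} {zero}  p≢y = refl
basis-offDiagonal {p = suc p} {suc y} p≢y = basis-offDiagonal (p≢y ∘ cong suc)

basis-injective : ∀ {K N} {f : Fin K → Fin N} → (∀ {a b} → f a ≡ f b → a ≡ b) →
                  ∀ a b → basis (f a) (f b) ≡ basis a b
basis-injective {f = f} f-inj a b with a ≟ b
... | yes refl = trans (basis-diagonal (f a)) (sym (basis-diagonal a))
... | no a≢b   = trans (basis-offDiagonal (a≢b ∘ f-inj)) (sym (basis-offDiagonal a≢b))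

sumFin-*-basis : ∀ {N} (f : Fin N → ℤ) p → sumFin (λ y → f y *ℤ basis p y) ≡ f p
sumFin-*-basis {suc N} f zero = begin
  f zero *ℤ 1ℤ +ℤ sumFin (λ y → f (suc y) *ℤ 0ℤ)
    ≡⟨ cong₂ _+ℤ_ (ℤ.*-identityʳ (f zero)) (sumFin-zero (ℤ.*-zeroʳ ∘ f ∘ suc)) ⟩
  f zero +ℤ 0ℤ
    ≡⟨ ℤ.+-identityʳ (f zero) ⟩
  f zero ∎
  where open ≡-Reasoning
sumFin-*-basis {suc N} f (suc p) = begin
  f zero *ℤ 0ℤ +ℤ sumFin (λ y → f (suc y) *ℤ basis p y)
    ≡⟨ cong₂ _+ℤ_ (ℤ.*-zeroʳ (f zero)) (sumFin-*-basis (f ∘ suc) p) ⟩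
  0ℤ +ℤ f (suc p)
    ≡⟨ ℤ.+-identityˡ (f (suc p)) ⟩
  f (suc p) ∎
  where open ≡-Reasoning

mulVec-basis : ∀ {N} (A : Fin N → Fin N → ℤ) p x → mulVec A (basis p) x ≡ A x p
mulVec-basis A p x = sumFin-*-basis (A x) p

mulVec-distrib-minus : ∀ {N} (A : Fin N → Fin N → ℤ) (u v : Fin N → ℤ) x →
                       mulVec A (λ y → u y - v y) x ≡ mulVec A u x - mulVec A v x
mulVec-distrib-minus A u v x = begin
  sumFin (λ y → A x y *ℤ (u y - v y))
    ≡⟨ sumFin-cong (λ y → *-distribˡ-minus (A x y) (u y) (v y)) ⟩
  sumFin (λ y → A x y *ℤ u y - A x y *ℤ v y)
    ≡⟨ sumFin-distrib-minus (λ y → A x y *ℤ u y) (λ y → A x y *ℤ v y) ⟩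
  mulVec A u x - mulVec A v x ∎
  where
  open ≡-Reasoning
  *-distribˡ-minus : ∀ a b c → a *ℤ (b - c) ≡ a *ℤ b - a *ℤ c
  *-distribˡ-minus = solve-∀

basis-difference-isEigenvector :
  ∀ {N} (A : Fin N → Fin N → ℤ) {p q} → p ≢ q → A p p ≡ A q q → A p q ≡ A q p →
  (∀ x → x ≢ p → x ≢ q → A x p ≡ A x q) →
  IsEigenvector A (A p p - A p q) (λ y → basis p y - basis q y)
basis-difference-isEigenvector A {p} {q} p≢q App≡Aqq Apq≡Aqp columns x = begin
  mulVec A (λ y → basis p y - basis q y) x
    ≡⟨ mulVec-distrib-minus A (basis p) (basis q) x ⟩
  mulVec A (basis p) x - mulVec A (basis q) x
    ≡⟨ cong₂ _-_ (mulVec-basis A p x) (mulVec-basis A q x) ⟩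
  A x p - A x q
    ≡⟨ entry (x ≟ p) (x ≟ q) ⟩
  (A p p - A p q) *ℤ (basis p x - basis q x) ∎
  where
  open ≡-Reasoning
  λ₀ = A p p - A p q
  swap : ∀ a b → b - a ≡ (a - b) *ℤ -[1+ 0 ]
  swap = solve-∀
  entry : _ → _ → A x p - A x q ≡ λ₀ *ℤ (basis p x - basis q x)
  entry (yes refl) _ rewrite basis-diagonal p | basis-offDiagonal {p = q} (p≢q ∘ sym) =
    sym (ℤ.*-identityʳ λ₀)
  entry (no _) (yes refl) rewrite basis-diagonal q | basis-offDiagonal {p = p} p≢q
                                | sym App≡Aqq | sym Apq≡Aqp = swap (A p p) (A p q)
  entry (no x≢p) (no x≢q)
    rewrite basis-offDiagonal (x≢p ∘ sym) | basis-offDiagonal (x≢q ∘ sym) | columns x x≢p x≢q =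
    trans (ℤ.+-inverseʳ (A x q)) (sym (ℤ.*-zeroʳ λ₀))

linIndep-biorthogonal : ∀ {K N} (vs : Fin K → Fin N → ℤ) (pt : Fin K → Fin N) →
                        (∀ a b → vs a (pt b) ≡ basis a b) → LinIndep vs
linIndep-biorthogonal vs pt biorthogonal c combination≡0 b = begin
  c b                                   ≡⟨ sym (sumFin-*-basis c b) ⟩
  sumFin (λ a → c a *ℤ basis b a)       ≡⟨ sumFin-cong (λ a → cong (c a *ℤ_) (evaluation a)) ⟩
  sumFin (λ a → c a *ℤ vs a (pt b))     ≡⟨ combination≡0 (pt b) ⟩
  0ℤ ∎
  where
  open ≡-Reasoning
  evaluation : ∀ a → basis b a ≡ vs a (pt b)
  evaluation a = trans (basis-comm b a) (sym (biorthogonal a b))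

firstFrom-hit : ∀ f p s → p s ≡ true → firstFrom f p s ≡ s
firstFrom-hit zero    p s ps = refl
firstFrom-hit (suc f) p s ps rewrite ps = refl

firstFrom-miss : ∀ f p s → p s ≡ false → firstFrom (suc f) p s ≡ firstFrom f p (suc s)
firstFrom-miss f p s ps rewrite ps = refl

firstFrom-≤ : ∀ f p {s d} → s ≤ d → p d ≡ true → firstFrom f p s ≤ d
firstFrom-≤ zero    p s≤d pd = s≤d
firstFrom-≤ (suc f) p {s} {d} s≤d pd with p s in ps
... | true  = s≤d
... | false = firstFrom-≤ f p (≤∧≢⇒< s≤d s≢d) pd
  where
  s≢d : s ≢ d
  s≢d refl with () ← trans (sym ps) pd

⌊x≟x⌋≡true : ∀ {N} (x : Fin N) → ⌊ x ≟ x ⌋ ≡ true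
⌊x≟x⌋≡true x = cong ⌊_⌋ (≡-≟-identity _≟_ refl)

⌊x≟y⌋≡false : ∀ {N} {x y : Fin N} → x ≢ y → ⌊ x ≟ y ⌋ ≡ false
⌊x≟y⌋≡false x≢y = cong ⌊_⌋ (≢-≟-identity _≟_ x≢y)

module _ {N} (G : Graph N) where

  walkWithin-refl : ∀ u → walkWithin G 0 u u ≡ true
  walkWithin-refl = ⌊x≟x⌋≡true

  walkWithin-distinct : ∀ {u v} → u ≢ v → walkWithin G 0 u v ≡ false
  walkWithin-distinct = ⌊x≟y⌋≡false

  walkWithin-suc : ∀ k u v → walkWithin G k u v ≡ true → walkWithin G (suc k) u v ≡ true
  walkWithin-suc k u v walk rewrite walk = refl

  walkWithin-step : ∀ k u w v → G u w ≡ true → walkWithin G k w v ≡ true →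
                    walkWithin G (suc k) u v ≡ true
  walkWithin-step k u w v uw walk
    rewrite anyFin-witness (λ w′ → G u w′ ∧ walkWithin G k w′ v) w (cong₂ _∧_ uw walk)
    = Bool.∨-zeroʳ _

  walkWithin-adjacent : ∀ u v → G u v ≡ true → walkWithin G 1 u v ≡ true
  walkWithin-adjacent u v uv = walkWithin-step 0 u v v uv (walkWithin-refl v)

  walkWithin-nonadjacent : ∀ u v → u ≢ v → G u v ≡ false → walkWithin G 1 u v ≡ false
  walkWithin-nonadjacent u v u≢v ¬uv
    rewrite walkWithin-distinct u≢v = anyFin-none _ noStep
    where
    noStep : ∀ w → (G u w ∧ ⌊ w ≟ v ⌋) ≡ false
    noStep w with w ≟ v
    ... | yes refl = cong (_∧ true) ¬uv
    ... | no _     = Bool.∧-zeroʳ (G u w)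

dist-refl : ∀ {N} (G : Graph N) u → dist G u u ≡ 0
dist-refl {N} G u = firstFrom-hit N (λ k → walkWithin G k u u) 0 (walkWithin-refl G u)

dist-adjacent : ∀ {N} (G : Graph N) u v → u ≢ v → G u v ≡ true → dist G u v ≡ 1
dist-adjacent {suc N} G u v u≢v uv =
  trans (firstFrom-miss N walk 0 (walkWithin-distinct G u≢v))
        (firstFrom-hit N walk 1 (walkWithin-adjacent G u v uv))
  where walk = λ k → walkWithin G k u v

dist-commonNeighbour : ∀ {N} (G : Graph N) u v w → u ≢ v → G u v ≡ false →
           G u w ≡ true → G w v ≡ true → dist G u v ≡ 2
dist-commonNeighbour {suc zero} G zero zero _ u≢v _ _ _ = ⊥-elim (u≢v refl)
dist-commonNeighbour {suc (suc N)} G u v w u≢v ¬uv uw wv =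
  trans (firstFrom-miss (suc N) walk 0 (walkWithin-distinct G u≢v))
  (trans (firstFrom-miss N walk 1 (walkWithin-nonadjacent G u v u≢v ¬uv))
         (firstFrom-hit N walk 2 (walkWithin-step G 1 u w v uw (walkWithin-adjacent G w v wv))))
  where walk = λ k → walkWithin G k u v

dist-≤ : ∀ {N} (G : Graph N) u v {d} → walkWithin G d u v ≡ true → dist G u v ≤ d
dist-≤ {N} G u v walk = firstFrom-≤ N (λ k → walkWithin G k u v) z≤n walk

dist≤ecc : ∀ {N} (G : Graph N) u v → dist G u v ≤ ecc G u
dist≤ecc G u = ≤-maxFin (dist G u)

ecc≤ : ∀ {N} (G : Graph N) u {c} → (∀ v → dist G u v ≤ c) → ecc G u ≤ c
ecc≤ G u {c} = maxFin-lub (dist G u) c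

eccMatrix-column : ∀ {N} (G : Graph N) u v → ecc G v ≤ ecc G u →
                   eccMatrix G u v ≡ (if dist G u v ≡ᵇ ecc G v then + dist G u v else 0ℤ)
eccMatrix-column G u v ev≤eu =
  cong (λ e → if dist G u v ≡ᵇ e then + dist G u v else 0ℤ) (m≥n⇒m⊓n≡n ev≤eu)

module CompleteBipartiteMinusEdge (m′ n′ : ℕ) (i : Fin (2 + m′)) (j : Fin (2 + n′)) where

  m n : ℕ
  m = 2 + m′
  n = 2 + n′

  G : Graph (m + n)
  G = KmnMinusEdge m n i j

  V : Set
  V = Fin m ⊎ Fin n

  adjacent : V → V → Bool
  adjacent (inj₁ a) (inj₂ b) = not (⌊ a ≟ i ⌋ ∧ ⌊ b ≟ j ⌋)
  adjacent (inj₂ b) (inj₁ a) = not (⌊ a ≟ i ⌋ ∧ ⌊ b ≟ j ⌋)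
  adjacent (inj₁ _) (inj₁ _) = false
  adjacent (inj₂ _) (inj₂ _) = false

  G-adjacent : ∀ x y → G x y ≡ adjacent (splitAt m x) (splitAt m y)
  G-adjacent x y with splitAt m x | splitAt m y
  ... | inj₁ _ | inj₂ _ = refl
  ... | inj₂ _ | inj₁ _ = refl
  ... | inj₁ _ | inj₁ _ = refl
  ... | inj₂ _ | inj₂ _ = refl

  inFirstPart : V → Bool
  inFirstPart (inj₁ _) = true
  inFirstPart (inj₂ _) = false

  NotEndpoint : V → Set
  NotEndpoint (inj₁ a) = a ≢ i
  NotEndpoint (inj₂ b) = b ≢ j

  adjacent-sym : ∀ s t → adjacent s t ≡ adjacent t s
  adjacent-sym (inj₁ _) (inj₁ _) = refl
  adjacent-sym (inj₁ _) (inj₂ _) = refl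
  adjacent-sym (inj₂ _) (inj₁ _) = refl
  adjacent-sym (inj₂ _) (inj₂ _) = refl

  adjacent-samePart : ∀ s t → inFirstPart s ≡ inFirstPart t → adjacent s t ≡ false
  adjacent-samePart (inj₁ _) (inj₁ _) _ = refl
  adjacent-samePart (inj₂ _) (inj₂ _) _ = refl

  adjacent-notEndpoint : ∀ s t → NotEndpoint t → inFirstPart s ≢ inFirstPart t →
                         adjacent s t ≡ true
  adjacent-notEndpoint (inj₁ a) (inj₂ b) b≢j _
    rewrite ⌊x≟y⌋≡false b≢j = cong not (Bool.∧-zeroʳ ⌊ a ≟ i ⌋)
  adjacent-notEndpoint (inj₂ b) (inj₁ a) a≢i _ rewrite ⌊x≟y⌋≡false a≢i = refl
  adjacent-notEndpoint (inj₁ _) (inj₁ _) _ different = ⊥-elim (different refl)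
  adjacent-notEndpoint (inj₂ _) (inj₂ _) _ different = ⊥-elim (different refl)

  anchor : Bool → V
  anchor true  = inj₁ (punchIn i zero)
  anchor false = inj₂ (punchIn j zero)

  anchor-notEndpoint : ∀ b → NotEndpoint (anchor b)
  anchor-notEndpoint true  = punchInᵢ≢i i zero
  anchor-notEndpoint false = punchInᵢ≢i j zero

  inFirstPart-anchor : ∀ b → inFirstPart (anchor b) ≡ b
  inFirstPart-anchor true  = refl
  inFirstPart-anchor false = refl

  partner : V → V
  partner (inj₁ a) = inj₁ (punchIn a zero)
  partner (inj₂ b) = inj₂ (punchIn b zero)

  partner-≢ : ∀ s → partner s ≢ s
  partner-≢ (inj₁ a) = punchInᵢ≢i a zero ∘ inj₁-injective
  partner-≢ (inj₂ b) = punchInᵢ≢i b zero ∘ inj₂-injective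

  inFirstPart-partner : ∀ s → inFirstPart (partner s) ≡ inFirstPart s
  inFirstPart-partner (inj₁ _) = refl
  inFirstPart-partner (inj₂ _) = refl

  vertex : V → Fin (m + n)
  vertex = join m n

  vertex-injective : ∀ {s t} → vertex s ≡ vertex t → s ≡ t
  vertex-injective {s} {t} eq =
    trans (sym (splitAt-join m n s)) (trans (cong (splitAt m) eq) (splitAt-join m n t))

  side : Fin (m + n) → Bool
  side x = inFirstPart (splitAt m x)

  side-vertex : ∀ s → side (vertex s) ≡ inFirstPart s
  side-vertex s = cong inFirstPart (splitAt-join m n s)

  OffEdge : Fin (m + n) → Set
  OffEdge x = NotEndpoint (splitAt m x)

  offEdge-vertex : ∀ s → NotEndpoint s → OffEdge (vertex s)
  offEdge-vertex s = subst NotEndpoint (sym (splitAt-join m n s))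

  G-sym : ∀ x y → G x y ≡ G y x
  G-sym x y = trans (G-adjacent x y)
    (trans (adjacent-sym (splitAt m x) (splitAt m y)) (sym (G-adjacent y x)))

  G-sameSide : ∀ x y → side x ≡ side y → G x y ≡ false
  G-sameSide x y x~y = trans (G-adjacent x y) (adjacent-samePart _ _ x~y)

  G-offEdge : ∀ x p → OffEdge p → side x ≢ side p → G x p ≡ true
  G-offEdge x p p-off x≁p = trans (G-adjacent x p) (adjacent-notEndpoint _ _ p-off x≁p)

  G-acrossAnchor : ∀ x → G x (vertex (anchor (not (side x)))) ≡ true
  G-acrossAnchor x = G-offEdge x (vertex across) (offEdge-vertex across (anchor-notEndpoint _))
    λ x~a → Bool.not-¬ refl (trans x~a (trans (side-vertex across) (inFirstPart-anchor _)))
    where across = anchor (not (side x))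

  commonNeighbour : ∀ x y → side x ≡ side y → ∃ λ w → G x w ≡ true × G w y ≡ true
  commonNeighbour x y x~y = vertex (anchor (not (side x))) , G-acrossAnchor x ,
    trans (G-sym (vertex (anchor (not (side x)))) y)
      (subst (λ b → G y (vertex (anchor (not b))) ≡ true) (sym x~y) (G-acrossAnchor y))

  dist-sameSide : ∀ x y → x ≢ y → side x ≡ side y → dist G x y ≡ 2
  dist-sameSide x y x≢y x~y with commonNeighbour x y x~y
  ... | w , xw , wy = dist-commonNeighbour G x y w x≢y (G-sameSide x y x~y) xw wy

  walkWithin-offEdge : ∀ p → OffEdge p → ∀ y → walkWithin G 2 p y ≡ true
  walkWithin-offEdge p p-off y with side p Bool.≟ side y
  ... | yes p~y with commonNeighbour p y p~y
  ...   | w , pw , wy = walkWithin-step G 1 p w y pw (walkWithin-adjacent G w y wy)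
  walkWithin-offEdge p p-off y | no p≁y =
    walkWithin-suc G 1 p y (walkWithin-adjacent G p y
      (trans (G-sym p y) (G-offEdge y p p-off (p≁y ∘ sym))))

  2≤ecc : ∀ x → 2 ≤ ecc G x
  2≤ecc x = ≤-trans (≤-reflexive (sym (dist-sameSide x y x≢y x~y))) (dist≤ecc G x y)
    where
    y = vertex (partner (splitAt m x))
    x≢y : x ≢ y
    x≢y eq = partner-≢ (splitAt m x)
      (trans (sym (splitAt-join m n _)) (cong (splitAt m) (sym eq)))
    x~y : side x ≡ side y
    x~y = sym (trans (side-vertex _) (inFirstPart-partner (splitAt m x)))

  ecc-offEdge : ∀ p → OffEdge p → ecc G p ≡ 2
  ecc-offEdge p p-off =
    ≤-antisym (ecc≤ G p λ y → dist-≤ G p y (walkWithin-offEdge p p-off y)) (2≤ecc p)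

  columnEntry : ℕ → ℤ
  columnEntry d = if d ≡ᵇ 2 then + d else 0ℤ

  eccMatrix-offEdge : ∀ p → OffEdge p → ∀ x → eccMatrix G x p ≡ columnEntry (dist G x p)
  eccMatrix-offEdge p p-off x = trans
    (eccMatrix-column G x p (≤-trans (≤-reflexive (ecc-offEdge p p-off)) (2≤ecc x)))
    (cong (λ e → if dist G x p ≡ᵇ e then + dist G x p else 0ℤ) (ecc-offEdge p p-off))

  eccMatrix-diagonal : ∀ p → OffEdge p → eccMatrix G p p ≡ 0ℤ
  eccMatrix-diagonal p p-off =
    trans (eccMatrix-offEdge p p-off p) (cong columnEntry (dist-refl G p))

  eccMatrix-sameSide : ∀ p x → OffEdge p → x ≢ p → side x ≡ side p → eccMatrix G x p ≡ + 2
  eccMatrix-sameSide p x p-off x≢p x~p =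
    trans (eccMatrix-offEdge p p-off x) (cong columnEntry (dist-sameSide x p x≢p x~p))

  eccMatrix-otherSide : ∀ p x → OffEdge p → side x ≢ side p → eccMatrix G x p ≡ 0ℤ
  eccMatrix-otherSide p x p-off x≁p = trans (eccMatrix-offEdge p p-off x)
    (cong columnEntry (dist-adjacent G x p (x≁p ∘ cong side) (G-offEdge x p p-off x≁p)))

  offEdgePair-isEigenvector : ∀ p q → OffEdge p → OffEdge q → p ≢ q → side p ≡ side q →
                              IsEigenvector (eccMatrix G) -[1+ 1 ] (λ y → basis p y - basis q y)
  offEdgePair-isEigenvector p q p-off q-off p≢q p~q =
    subst (λ λ₀ → IsEigenvector (eccMatrix G) λ₀ (λ y → basis p y - basis q y))
      (cong₂ _-_ (eccMatrix-diagonal p p-off) (eccMatrix-sameSide q p q-off p≢q p~q))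
      (basis-difference-isEigenvector (eccMatrix G) p≢q
        (trans (eccMatrix-diagonal p p-off) (sym (eccMatrix-diagonal q q-off)))
        (trans (eccMatrix-sameSide q p q-off p≢q p~q)
               (sym (eccMatrix-sameSide p q p-off (p≢q ∘ sym) (sym p~q))))
        columns)
    where
    columns : ∀ x → x ≢ p → x ≢ q → eccMatrix G x p ≡ eccMatrix G x q
    columns x x≢p x≢q with side x Bool.≟ side p
    ... | yes x~p = trans (eccMatrix-sameSide p x p-off x≢p x~p)
                          (sym (eccMatrix-sameSide q x q-off x≢q (trans x~p p~q)))
    ... | no x≁p  = trans (eccMatrix-otherSide p x p-off x≁p)
                          (sym (eccMatrix-otherSide q x q-off (x≁p ∘ flip trans (sym p~q))))

  -- punchIn i enumerates Fin m ∖ {i}: its value at zero is the anchor of the first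
  -- part and its values at suc a are the spare vertices (likewise for j).
  spare : Fin m′ ⊎ Fin n′ → V
  spare (inj₁ a) = inj₁ (punchIn i (suc a))
  spare (inj₂ b) = inj₂ (punchIn j (suc b))

  spare-notEndpoint : ∀ t → NotEndpoint (spare t)
  spare-notEndpoint (inj₁ a) = punchInᵢ≢i i (suc a)
  spare-notEndpoint (inj₂ b) = punchInᵢ≢i j (suc b)

  spare-injective : ∀ t u → spare t ≡ spare u → t ≡ u
  spare-injective (inj₁ a) (inj₁ b) eq =
    cong inj₁ (suc-injective (punchIn-injective i (suc a) (suc b) (inj₁-injective eq)))
  spare-injective (inj₂ a) (inj₂ b) eq =
    cong inj₂ (suc-injective (punchIn-injective j (suc a) (suc b) (inj₂-injective eq)))

  spare≢anchor : ∀ t b → spare t ≢ anchor b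
  spare≢anchor (inj₁ a) true eq with () ← punchIn-injective i (suc a) zero (inj₁-injective eq)
  spare≢anchor (inj₂ b) false eq with () ← punchIn-injective j (suc b) zero (inj₂-injective eq)

  K : ℕ
  K = m′ + n′

  spareVertex anchorVertex : Fin K → Fin (m + n)
  spareVertex  k = vertex (spare (splitAt m′ k))
  anchorVertex k = vertex (anchor (inFirstPart (spare (splitAt m′ k))))

  spareVertex-injective : ∀ {k l} → spareVertex k ≡ spareVertex l → k ≡ l
  spareVertex-injective {k} {l} eq = begin
    k
      ≡⟨ sym (join-splitAt m′ n′ k) ⟩
    join m′ n′ (splitAt m′ k)
      ≡⟨ cong (join m′ n′) (spare-injective (splitAt m′ k) (splitAt m′ l) (vertex-injective eq)) ⟩
    join m′ n′ (splitAt m′ l)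
      ≡⟨ join-splitAt m′ n′ l ⟩
    l ∎
    where open ≡-Reasoning

  eigenvectors : Fin K → Fin (m + n) → ℤ
  eigenvectors k y = basis (spareVertex k) y - basis (anchorVertex k) y

  eigenvectors-biorthogonal : ∀ k l → eigenvectors k (spareVertex l) ≡ basis k l
  eigenvectors-biorthogonal k l = trans
    (cong₂ _-_ (basis-injective spareVertex-injective k l)
               (basis-offDiagonal (spare≢anchor (splitAt m′ l) b ∘ vertex-injective ∘ sym)))
    (ℤ.+-identityʳ (basis k l))
    where b = inFirstPart (spare (splitAt m′ k))

  eigMultAtLeast : EigMultAtLeast (eccMatrix G) -[1+ 1 ] K
  eigMultAtLeast =
    eigenvectors ,
    linIndep-biorthogonal eigenvectors spareVertex eigenvectors-biorthogonal ,
    λ k → let t = splitAt m′ k; b = inFirstPart (spare t) in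
      offEdgePair-isEigenvector (spareVertex k) (anchorVertex k)
        (offEdge-vertex (spare t) (spare-notEndpoint t))
        (offEdge-vertex (anchor b) (anchor-notEndpoint b))
        (spare≢anchor t b ∘ vertex-injective)
        (trans (side-vertex (spare t))
               (sym (trans (side-vertex (anchor b)) (inFirstPart-anchor b))))

lemma2p1 : (m n : ℕ) → 2 ≤ m → 2 ≤ n → (i : Fin m) → (j : Fin n) →
    EigMultAtLeast (eccMatrix (KmnMinusEdge m n i j)) -[1+ 1 ] (m + n ∸ 4)
lemma2p1 (suc (suc m′)) (suc (suc n′)) (s≤s (s≤s z≤n)) (s≤s (s≤s z≤n)) i j =
  subst (EigMultAtLeast (eccMatrix (KmnMinusEdge _ _ i j)) -[1+ 1 ])
    (sym (+-∸-assoc m′ {2 + n′} (s≤s (s≤s z≤n))))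
    (CompleteBipartiteMinusEdge.eigMultAtLeast m′ n′ i j)
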